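{- Let $n\ge 3$ be odd and let $\mathcal{G}=(K_{n-1}-M)+K_1$, where $M$ is a perfect matching of $K_{n-1}$. Then the lexicographic product $\mathcal{G}\circ C_4$ is not distance magic.
   Context: $G+K_1$ denotes the join of $G$ with a single new vertex adjacent to all vertices of $G$. The lexicographic product $G\circ H$ has vertex set $V(G)\times V(H)$, with $(g,h)\sim(g',h')$ iff $gg'\in E(G)$, or $g=g'$ and $hh'\in E(H)$. A distance magic labeling of a graph on $N$ vertices is a bijection $f:V\to\{1,\dots,N\}$ such that $\sum_{v\in N(u)}f(v)$ is the same for all vertices $u$; a graph is distance magic if it has one. -}

module Defs where

open import Data.Nat using (ℕ; zero; suc; _+_; _*_; _%_)
open import Data.Nat.Properties using () renaming (_≟_ to _≟ℕ_)
open import Data.Fin using (Fin; zero; suc; toℕ; remQuot)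
open import Data.Fin.Properties using (_≟_)
open import Data.Bool using (Bool; true; false; not; _∧_; _∨_; if_then_else_)
open import Data.List using (List; map; allFin)
open import Data.Nat.ListAction using (sum)
open import Data.Product using (Σ; _,_; _×_)
open import Function.Definitions using (Bijective)
open import Relation.Binary.PropositionalEquality using (_≡_)
open import Relation.Nullary.Decidable using (⌊_⌋)

record Graph : Set where
  field
    size : ℕ
    adj  : Fin size → Fin size → Bool
open Graph public

-- K_k - M, where the perfect matching M of K_k is given by its partner map
-- m (an involution without fixed points; i is matched to m i).
KminusM : (k : ℕ) → (Fin k → Fin k) → Graph
KminusM k m = record
  { size = k
  ; adj  = λ i j → not ⌊ i ≟ j ⌋ ∧ not ⌊ m i ≟ j ⌋ }

joinK1 : Graph → Graph
joinK1 G = record { size = suc (size G) ; adj = a }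
  where
  a : Fin (suc (size G)) → Fin (suc (size G)) → Bool
  a zero    zero    = false
  a zero    (suc _) = true
  a (suc _) zero    = true
  a (suc i) (suc j) = adj G i j

cycle : (n : ℕ) → Graph
cycle zero    = record { size = zero ; adj = λ _ _ → false }
cycle (suc n) = record
  { size = suc n
  ; adj  = λ i j → ⌊ toℕ j ≟ℕ ((toℕ i + 1) % suc n) ⌋
                 ∨ ⌊ toℕ i ≟ℕ ((toℕ j + 1) % suc n) ⌋ }

lex : Graph → Graph → Graph
lex G H = record { size = size G * size H ; adj = a }
  where
  a : Fin (size G * size H) → Fin (size G * size H) → Bool
  a u v with remQuot {size G} (size H) u | remQuot {size G} (size H) v
  ... | (g , h) | (g' , h') = adj G g g' ∨ (⌊ g ≟ g' ⌋ ∧ adj H h h')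

neighSum : (G : Graph) → (Fin (size G) → ℕ) → Fin (size G) → ℕ
neighSum G ℓ u = sum (map (λ v → if adj G u v then ℓ v else 0) (allFin (size G)))

-- Distance magic: a bijection f : V → {1,…,N} (encoded as v ↦ 1 + toℕ (f v) with
-- f : Fin N → Fin N bijective) whose neighbourhood sums are all equal to some k.
DistanceMagic : Graph → Set
DistanceMagic G =
  Σ (Fin (size G) → Fin (size G)) λ f →
    Bijective _≡_ _≡_ f
    × Σ ℕ λ k → ∀ u → neighSum G (λ v → suc (toℕ (f v))) u ≡ k

{-# OPTIONS --safe #-}
module Submission where

-- In G ∘ C₄ the neighbourhood sum of (g, h) is the sum of the layers over the G-neighbours of g
-- plus the neighbourhood sum of h within the layer of g.  Comparing h = 0 with h = 1 shows that
-- in a distance magic labelling both antipodal pairs of a layer have the same sum p g, so the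
-- layer sums to 2 p g.  Comparing a vertex i of K_{n-1} - M with its partner m i then forces
-- p(apex) = 3 p i, hence the total label sum N(N+1)/2, with N = 4n, equals 2 p(apex) (n+2)/3.
-- But p(apex) is the sum of two distinct labels, so p(apex) ≤ 2N − 1, which is too small.

open import Defs
open import Data.Nat using (ℕ; zero; suc; _+_; _*_; _≤_; _<_; _∸_; _%_; s≤s; s≤s⁻¹)
open import Data.Nat.Properties hiding (_≟_)
open import Data.Nat.Tactic.RingSolver using (solve-∀)
open import Data.Fin using (Fin; zero; suc; toℕ; fromℕ; inject₁; combine; _↑ˡ_; _↑ʳ_)
open import Data.Fin.Patterns using (0F; 1F; 2F; 3F)
open import Data.Fin.Properties using (_≟_; toℕ<n; toℕ-inject₁; toℕ-fromℕ; toℕ-injective; remQuot-combine; combine-injectiveʳ)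
open import Data.Fin.Permutation using (Permutation; permutation)
open import Data.Bool using (true; false; not; _∧_; _∨_; if_then_else_)
open import Data.List using (map; allFin; tabulate)
open import Data.List.Properties using (map-tabulate)
import Data.Nat.ListAction as List
open import Data.Product using (_,_; _×_; proj₁; proj₂)
open import Data.Empty using (⊥-elim)
open import Function using (_∘_)
open import Function.Definitions using (Bijective)
open import Relation.Binary.PropositionalEquality
open import Relation.Binary.Definitions using (tri<; tri≈; tri>)
open import Relation.Nullary using (¬_; Dec; yes; no)
open import Relation.Nullary.Decidable using (⌊_⌋; ⌊⌋-map′)
open import Algebra.Properties.CommutativeMonoid.Sum +-0-commutativeMonoid
  using (sum-syntax; ∑-distrib-+; sum-cong-≗; sum-permute; sum-init-last; sum-replicate-zero)
import Algebra.Properties.Semiring.Sum +-*-semiring as SemiringSum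
open import Algebra.Properties.CommutativeSemigroup +-commutativeSemigroup using (xy∙z≈xz∙y)

∑-const : ∀ n {f : Fin n → ℕ} {c} → (∀ i → f i ≡ c) → ∑[ i < n ] f i ≡ n * c
∑-const zero    f≡c = refl
∑-const (suc n) f≡c = cong₂ _+_ (f≡c zero) (∑-const n (f≡c ∘ suc))

∑-↑ : ∀ b c (f : Fin (b + c) → ℕ) →
  ∑[ i < b + c ] f i ≡ ∑[ i < b ] f (i ↑ˡ c) + ∑[ j < c ] f (b ↑ʳ j)
∑-↑ zero    c f = refl
∑-↑ (suc b) c f = trans (cong (f zero +_) (∑-↑ b c (f ∘ suc))) (sym (+-assoc (f zero) _ _))

∑-combine : ∀ a b (f : Fin (a * b) → ℕ) →
  ∑[ v < a * b ] f v ≡ ∑[ i < a ] ∑[ j < b ] f (combine i j)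
∑-combine zero    b f = refl
∑-combine (suc a) b f =
  trans (∑-↑ b (a * b) f) (cong (∑[ j < b ] f (j ↑ˡ a * b) +_) (∑-combine a b (f ∘ (b ↑ʳ_))))

∑-delta : ∀ n (i : Fin n) (u : Fin n → ℕ) → ∑[ j < n ] (if ⌊ i ≟ j ⌋ then u j else 0) ≡ u i
∑-delta (suc n) zero    u = trans (cong (u zero +_) (sum-replicate-zero n)) (+-identityʳ (u zero))
∑-delta (suc n) (suc i) u =
  trans (sum-cong-≗ (λ j → cong (if_then u (suc j) else 0) (⌊⌋-map′ _ _ (i ≟ j)))) (∑-delta n i (u ∘ suc))

sum-map-allFin : ∀ n (f : Fin n → ℕ) → List.sum (map f (allFin n)) ≡ ∑[ i < n ] f i
sum-map-allFin n f = trans (cong List.sum (map-tabulate (λ i → i) f)) (sum-tabulate n f)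
  where
  sum-tabulate : ∀ n (f : Fin n → ℕ) → List.sum (tabulate f) ≡ ∑[ i < n ] f i
  sum-tabulate zero    f = refl
  sum-tabulate (suc n) f = cong (f zero +_) (sum-tabulate n (f ∘ suc))

∑-bijection : ∀ n (u : Fin n → ℕ) {f : Fin n → Fin n} → Bijective _≡_ _≡_ f →
  ∑[ i < n ] u (f i) ≡ ∑[ i < n ] u i
∑-bijection n u {f} (f-inj , f-surj) = sym (sum-permute u π)
  where
  f⁻¹ : Fin n → Fin n
  f⁻¹ y = proj₁ (f-surj y)
  f∘f⁻¹ : ∀ y → f (f⁻¹ y) ≡ y
  f∘f⁻¹ y = proj₂ (f-surj y) refl
  π : Permutation n n
  π = permutation f f⁻¹ f∘f⁻¹ (λ x → f-inj (f∘f⁻¹ (f x)))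

∑-suc-toℕ : ∀ n → 2 * ∑[ i < n ] suc (toℕ i) ≡ n * suc n
∑-suc-toℕ zero    = refl
∑-suc-toℕ (suc n) = begin
  2 * ∑[ i < suc n ] suc (toℕ i)
    ≡⟨ cong (2 *_) (sum-init-last {n} (λ i → suc (toℕ i))) ⟩
  2 * (∑[ i < n ] suc (toℕ (inject₁ i)) + suc (toℕ (fromℕ n)))
    ≡⟨ cong₂ (λ s l → 2 * (s + suc l)) (sum-cong-≗ {n} (λ i → cong suc (toℕ-inject₁ i))) (toℕ-fromℕ n) ⟩
  2 * (∑[ i < n ] suc (toℕ i) + suc n)
    ≡⟨ *-distribˡ-+ 2 (∑[ i < n ] suc (toℕ i)) (suc n) ⟩
  2 * ∑[ i < n ] suc (toℕ i) + 2 * suc n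
    ≡⟨ cong (_+ 2 * suc n) (∑-suc-toℕ n) ⟩
  n * suc n + 2 * suc n
    ≡⟨ gauss-step n ⟩
  suc n * suc (suc n) ∎
  where
  open ≡-Reasoning
  gauss-step : ∀ n → n * suc n + 2 * suc n ≡ suc n * suc (suc n)
  gauss-step = solve-∀

Loopless : Graph → Set
Loopless G = ∀ g → adj G g g ≡ false

neighSum≡∑ : ∀ G (w : Fin (size G) → ℕ) u →
  neighSum G w u ≡ ∑[ v < size G ] (if adj G u v then w v else 0)
neighSum≡∑ G w u = sum-map-allFin (size G) (λ v → if adj G u v then w v else 0)

layer : ∀ {a b} → (Fin (a * b) → ℕ) → Fin a → Fin b → ℕ
layer ℓ g h = ℓ (combine g h)

layerSum : ∀ {a} b → (Fin (a * b) → ℕ) → Fin a → ℕ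
layerSum b ℓ g = ∑[ h < b ] layer ℓ g h

adj-lex : ∀ G H g g′ h h′ →
  adj (lex G H) (combine g h) (combine g′ h′) ≡ adj G g g′ ∨ (⌊ g ≟ g′ ⌋ ∧ adj H h h′)
adj-lex G H g g′ h h′ =
  cong₂ (λ (x x′ : Fin (size G) × Fin (size H)) → adj G (proj₁ x) (proj₁ x′) ∨ (⌊ proj₁ x ≟ proj₁ x′ ⌋ ∧ adj H (proj₂ x) (proj₂ x′)))
    (remQuot-combine g h) (remQuot-combine g′ h′)

neighSum-lex : ∀ G H → Loopless G → (ℓ : Fin (size G * size H) → ℕ) → ∀ g h →
  neighSum (lex G H) ℓ (combine g h) ≡ neighSum G (layerSum (size H) ℓ) g + neighSum H (layer ℓ g) h
neighSum-lex G H loopless ℓ g h = begin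
  neighSum (lex G H) ℓ (combine g h)
    ≡⟨ neighSum≡∑ (lex G H) ℓ (combine g h) ⟩
  ∑[ v < size G * size H ] (if adj (lex G H) (combine g h) v then ℓ v else 0)
    ≡⟨ ∑-combine (size G) (size H) _ ⟩
  ∑[ g′ < size G ] ∑[ h′ < size H ] (if adj (lex G H) (combine g h) (combine g′ h′) then layer ℓ g′ h′ else 0)
    ≡⟨ sum-cong-≗ {size G} layer-contribution ⟩
  ∑[ g′ < size G ] (outer g′ + (if ⌊ g ≟ g′ ⌋ then inner else 0))
    ≡⟨ ∑-distrib-+ outer (λ g′ → if ⌊ g ≟ g′ ⌋ then inner else 0) ⟩
  ∑[ g′ < size G ] outer g′ + ∑[ g′ < size G ] (if ⌊ g ≟ g′ ⌋ then inner else 0)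
    ≡⟨ cong₂ _+_ (sym (neighSum≡∑ G (layerSum (size H) ℓ) g)) (∑-delta (size G) g (λ _ → inner)) ⟩
  neighSum G (layerSum (size H) ℓ) g + inner
    ≡⟨ cong (neighSum G (layerSum (size H) ℓ) g +_) (sym (neighSum≡∑ H (layer ℓ g) h)) ⟩
  neighSum G (layerSum (size H) ℓ) g + neighSum H (layer ℓ g) h ∎
  where
  open ≡-Reasoning
  outer : Fin (size G) → ℕ
  outer g′ = if adj G g g′ then layerSum (size H) ℓ g′ else 0
  inner : ℕ
  inner = ∑[ h′ < size H ] (if adj H h h′ then layer ℓ g h′ else 0)
  layer-contribution : ∀ g′ →
    ∑[ h′ < size H ] (if adj (lex G H) (combine g h) (combine g′ h′) then layer ℓ g′ h′ else 0)
      ≡ outer g′ + (if ⌊ g ≟ g′ ⌋ then inner else 0)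
  layer-contribution g′ =
    trans (sum-cong-≗ {size H} (λ h′ → cong (if_then layer ℓ g′ h′ else 0) (adj-lex G H g g′ h h′)))
          (by-cases (g ≟ g′))
    where
    by-cases : (g≟g′ : Dec (g ≡ g′)) →
      ∑[ h′ < size H ] (if adj G g g′ ∨ (⌊ g≟g′ ⌋ ∧ adj H h h′) then layer ℓ g′ h′ else 0)
        ≡ outer g′ + (if ⌊ g≟g′ ⌋ then inner else 0)
    by-cases (yes refl) rewrite loopless g = refl
    by-cases (no _) with adj G g g′
    ... | true  = sym (+-identityʳ _)
    ... | false = sum-replicate-zero (size H)

neighSum-C4-0 : (x : Fin 4 → ℕ) → neighSum (cycle 4) x 0F ≡ x 1F + x 3F
neighSum-C4-0 x = cong (x 1F +_) (+-identityʳ (x 3F))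

neighSum-C4-1 : (x : Fin 4 → ℕ) → neighSum (cycle 4) x 1F ≡ x 0F + x 2F
neighSum-C4-1 x = cong (x 0F +_) (+-identityʳ (x 2F))

antipodalSum : ∀ {a} → (Fin (a * 4) → ℕ) → Fin a → ℕ
antipodalSum ℓ g = layer ℓ g 0F + layer ℓ g 2F

module _ (G : Graph) (loopless : Loopless G) (ℓ : Fin (size G * 4) → ℕ) {k : ℕ}
         (magic : ∀ u → neighSum (lex G (cycle 4)) ℓ u ≡ k) where

  lex-C4-magic : ∀ g → neighSum G (layerSum 4 ℓ) g + antipodalSum ℓ g ≡ k
  lex-C4-magic g = begin
    neighSum G (layerSum 4 ℓ) g + antipodalSum ℓ g
      ≡⟨ cong (neighSum G (layerSum 4 ℓ) g +_) (sym (neighSum-C4-1 (layer ℓ g))) ⟩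
    neighSum G (layerSum 4 ℓ) g + neighSum (cycle 4) (layer ℓ g) 1F
      ≡⟨ sym (neighSum-lex G (cycle 4) loopless ℓ g 1F) ⟩
    neighSum (lex G (cycle 4)) ℓ (combine g 1F)
      ≡⟨ magic (combine g 1F) ⟩
    k ∎
    where open ≡-Reasoning

  layerSum-C4 : ∀ g → layerSum 4 ℓ g ≡ antipodalSum ℓ g + antipodalSum ℓ g
  layerSum-C4 g = trans (regroup (x 0F) (x 1F) (x 2F) (x 3F)) (cong (antipodalSum ℓ g +_) balanced)
    where
    x : Fin 4 → ℕ
    x = layer ℓ g
    regroup : ∀ a b c d → a + (b + (c + (d + 0))) ≡ (a + c) + (b + d)
    regroup = solve-∀
    balanced : x 1F + x 3F ≡ antipodalSum ℓ g
    balanced = +-cancelˡ-≡ (neighSum G (layerSum 4 ℓ) g) _ _ (begin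
      neighSum G (layerSum 4 ℓ) g + (x 1F + x 3F)
        ≡⟨ cong (neighSum G (layerSum 4 ℓ) g +_) (sym (neighSum-C4-0 x)) ⟩
      neighSum G (layerSum 4 ℓ) g + neighSum (cycle 4) x 0F
        ≡⟨ sym (neighSum-lex G (cycle 4) loopless ℓ g 0F) ⟩
      neighSum (lex G (cycle 4)) ℓ (combine g 0F)
        ≡⟨ magic (combine g 0F) ⟩
      k
        ≡⟨ sym (lex-C4-magic g) ⟩
      neighSum G (layerSum 4 ℓ) g + antipodalSum ℓ g ∎)
      where open ≡-Reasoning

joinK1-loopless : ∀ G → Loopless G → Loopless (joinK1 G)
joinK1-loopless G loopless zero    = refl
joinK1-loopless G loopless (suc g) = loopless g

neighSum-joinK1-apex : ∀ G (w : Fin (suc (size G)) → ℕ) →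
  neighSum (joinK1 G) w zero ≡ ∑[ i < size G ] w (suc i)
neighSum-joinK1-apex G w = neighSum≡∑ (joinK1 G) w zero

neighSum-joinK1-suc : ∀ G (w : Fin (suc (size G)) → ℕ) i →
  neighSum (joinK1 G) w (suc i) ≡ w zero + neighSum G (w ∘ suc) i
neighSum-joinK1-suc G w i =
  trans (neighSum≡∑ (joinK1 G) w (suc i)) (cong (w zero +_) (sym (neighSum≡∑ G (w ∘ suc) i)))

KminusM-loopless : ∀ k m → Loopless (KminusM k m)
KminusM-loopless k m i with i ≟ i
... | yes _   = refl
... | no i≢i = ⊥-elim (i≢i refl)

neighSum-KminusM : ∀ k m (w : Fin k → ℕ) i → m i ≢ i →
  neighSum (KminusM k m) w i + w i + w (m i) ≡ ∑[ j < k ] w j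
neighSum-KminusM k m w i mi≢i = sym (begin
  ∑[ j < k ] w j
    ≡⟨ sum-cong-≗ {k} split ⟩
  ∑[ j < k ] (rest j + at i j + at (m i) j)
    ≡⟨ ∑-distrib-+ (λ j → rest j + at i j) (at (m i)) ⟩
  ∑[ j < k ] (rest j + at i j) + ∑[ j < k ] at (m i) j
    ≡⟨ cong (_+ ∑[ j < k ] at (m i) j) (∑-distrib-+ rest (at i)) ⟩
  ∑[ j < k ] rest j + ∑[ j < k ] at i j + ∑[ j < k ] at (m i) j
    ≡⟨ cong₂ _+_ (cong₂ _+_ (sym (neighSum≡∑ (KminusM k m) w i)) (∑-delta k i w)) (∑-delta k (m i) w) ⟩
  neighSum (KminusM k m) w i + w i + w (m i) ∎)
  where
  open ≡-Reasoning
  rest : Fin k → ℕ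
  at : Fin k → Fin k → ℕ
  rest j = if not ⌊ i ≟ j ⌋ ∧ not ⌊ m i ≟ j ⌋ then w j else 0
  at i′ j = if ⌊ i′ ≟ j ⌋ then w j else 0
  split : ∀ j → w j ≡ rest j + at i j + at (m i) j
  split j with i ≟ j | m i ≟ j
  ... | yes refl | yes mi≡i = ⊥-elim (mi≢i mi≡i)
  ... | yes refl | no _     = sym (+-identityʳ _)
  ... | no _     | yes refl = refl
  ... | no _     | no _     = sym (trans (+-identityʳ _) (+-identityʳ _))

matched-pair-ratio : ∀ {k R p₀ p q b b′} →
  k ≡ R + p₀ → k ≡ p₀ + p₀ + b + p → k ≡ p₀ + p₀ + b′ + q →
  b + (p + p) + (q + q) ≡ R → b′ + (q + q) + (p + p) ≡ R → p₀ ≡ 3 * p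
matched-pair-ratio {k} {R} {p₀} {p} {q} {b} {b′} apex vertex partner rim partner-rim
  with refl ← +-cancelʳ-≡ (p + p) b b′ (+-cancelʳ-≡ (q + q) _ _
                 (trans rim (trans (sym partner-rim) (xy∙z≈xz∙y b′ (q + q) (p + p)))))
  with refl ← +-cancelˡ-≡ (p₀ + p₀ + b) p q (trans (sym vertex) partner)
  = sym (+-cancelˡ-≡ (p₀ + (b + p)) (3 * p) p₀ (begin
      p₀ + (b + p) + 3 * p       ≡⟨ regroup-rim p₀ b p ⟩
      b + (p + p) + (p + p) + p₀ ≡⟨ cong (_+ p₀) rim ⟩
      R + p₀                     ≡⟨ trans (sym apex) vertex ⟩
      p₀ + p₀ + b + p            ≡⟨ regroup-vertex p₀ b p ⟩
      p₀ + (b + p) + p₀          ∎))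
  where
  open ≡-Reasoning
  regroup-rim : ∀ p₀ b p → p₀ + (b + p) + 3 * p ≡ b + (p + p) + (p + p) + p₀
  regroup-rim = solve-∀
  regroup-vertex : ∀ p₀ b p → p₀ + p₀ + b + p ≡ p₀ + (b + p) + p₀
  regroup-vertex = solve-∀

module _ {K} (m : Fin K → Fin K) (m-involutive : ∀ i → m (m i) ≡ i) (m-fixpoint-free : ∀ i → m i ≢ i)
         (ℓ : Fin (suc K * 4) → ℕ) {k : ℕ}
         (magic : ∀ u → neighSum (lex (joinK1 (KminusM K m)) (cycle 4)) ℓ u ≡ k) where

  private
    S : Fin (suc K) → ℕ
    S = layerSum {suc K} 4 ℓ
    p : Fin (suc K) → ℕ
    p = antipodalSum {suc K} ℓ
    R : ℕ
    R = ∑[ i < K ] S (suc i)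
    B : Fin K → ℕ
    B = neighSum (KminusM K m) (S ∘ suc)
    loopless : Loopless (joinK1 (KminusM K m))
    loopless = joinK1-loopless (KminusM K m) (KminusM-loopless K m)
    S≡p+p : ∀ g → S g ≡ p g + p g
    S≡p+p = layerSum-C4 (joinK1 (KminusM K m)) loopless ℓ magic
    magic-at : ∀ g → neighSum (joinK1 (KminusM K m)) S g + p g ≡ k
    magic-at = lex-C4-magic (joinK1 (KminusM K m)) loopless ℓ magic

    apex : k ≡ R + p zero
    apex = trans (sym (magic-at zero)) (cong (_+ p zero) (neighSum-joinK1-apex (KminusM K m) S))

    vertex : ∀ i → k ≡ p zero + p zero + B i + p (suc i)
    vertex i = trans (sym (magic-at (suc i)))
      (cong (_+ p (suc i)) (trans (neighSum-joinK1-suc (KminusM K m) S i) (cong (_+ B i) (S≡p+p zero))))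

    rim : ∀ i → B i + (p (suc i) + p (suc i)) + (p (suc (m i)) + p (suc (m i))) ≡ R
    rim i = trans (cong₂ (λ x y → B i + x + y) (sym (S≡p+p (suc i))) (sym (S≡p+p (suc (m i)))))
                  (neighSum-KminusM K m (S ∘ suc) i (m-fixpoint-free i))

    partner-rim : ∀ i → B (m i) + (p (suc (m i)) + p (suc (m i))) + (p (suc i) + p (suc i)) ≡ R
    partner-rim i = subst (λ j → B (m i) + (p (suc (m i)) + p (suc (m i))) + (p (suc j) + p (suc j)) ≡ R)
                          (m-involutive i) (rim (m i))

  apex-antipodalSum : ∀ i → antipodalSum {suc K} ℓ zero ≡ 3 * antipodalSum {suc K} ℓ (suc i)
  apex-antipodalSum i = matched-pair-ratio apex (vertex i) (vertex (m i)) (rim i) (partner-rim i)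

  total-weight : 3 * ∑[ v < suc K * 4 ] ℓ v ≡ (3 + K) * (antipodalSum {suc K} ℓ zero + antipodalSum {suc K} ℓ zero)
  total-weight = begin
    3 * ∑[ v < suc K * 4 ] ℓ v      ≡⟨ cong (3 *_) (∑-combine (suc K) 4 ℓ) ⟩
    3 * (S zero + R)                 ≡⟨ *-distribˡ-+ 3 (S zero) R ⟩
    3 * S zero + 3 * R               ≡⟨ cong₂ _+_ (cong (3 *_) (S≡p+p zero)) three-R ⟩
    3 * (p₀ + p₀) + K * (p₀ + p₀)    ≡⟨ sym (*-distribʳ-+ (p₀ + p₀) 3 K) ⟩
    (3 + K) * (p₀ + p₀)              ∎
    where
    open ≡-Reasoning
    p₀ : ℕ
    p₀ = p zero
    three-R : 3 * R ≡ K * (p₀ + p₀)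
    three-R = trans (SemiringSum.*-distribˡ-sum 3 (S ∘ suc)) (∑-const K (λ i → begin
      3 * S (suc i)                  ≡⟨ cong (3 *_) (S≡p+p (suc i)) ⟩
      3 * (p (suc i) + p (suc i))    ≡⟨ *-distribˡ-+ 3 (p (suc i)) (p (suc i)) ⟩
      3 * p (suc i) + 3 * p (suc i)  ≡⟨ cong (λ x → x + x) (sym (apex-antipodalSum i)) ⟩
      p₀ + p₀                        ∎))

m<n<o⇒suc[m]+suc[n]<o+o : ∀ {m n o} → m < n → n < o → suc m + suc n < o + o
m<n<o⇒suc[m]+suc[n]<o+o m<n n<o = +-mono-≤ (≤-trans (s≤s m<n) n<o) n<o

suc-toℕ-+-distinct-< : ∀ {N} {a b : Fin N} → a ≢ b → suc (toℕ a) + suc (toℕ b) < N + N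
suc-toℕ-+-distinct-< {N} {a} {b} a≢b with <-cmp (toℕ a) (toℕ b)
... | tri< a<b _ _ = m<n<o⇒suc[m]+suc[n]<o+o a<b (toℕ<n b)
... | tri≈ _ a≡b _ = ⊥-elim (a≢b (toℕ-injective a≡b))
... | tri> _ _ b<a = subst (_< N + N) (+-comm (suc (toℕ b)) (suc (toℕ a))) (m<n<o⇒suc[m]+suc[n]<o+o b<a (toℕ<n a))

apex-weight-equation : ∀ t p T →
  2 * T ≡ (3 + t) * 4 * suc ((3 + t) * 4) → 3 * T ≡ (5 + t) * (p + p) →
  p * (5 + t) ≡ 3 * (3 + t) * (13 + 4 * t)
apex-weight-equation t p T two-T three-T = *-cancelˡ-≡ _ _ 4 (begin
  4 * (p * (5 + t))                       ≡⟨ weight-regroup p t ⟩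
  2 * ((5 + t) * (p + p))                 ≡⟨ cong (2 *_) (sym three-T) ⟩
  2 * (3 * T)                             ≡⟨ trans (sym (*-assoc 2 3 T)) (*-assoc 3 2 T) ⟩
  3 * (2 * T)                             ≡⟨ cong (3 *_) two-T ⟩
  3 * ((3 + t) * 4 * suc ((3 + t) * 4))   ≡⟨ count-regroup t ⟩
  4 * (3 * (3 + t) * (13 + 4 * t))        ∎)
  where
  open ≡-Reasoning
  weight-regroup : ∀ p t → 4 * (p * (5 + t)) ≡ 2 * ((5 + t) * (p + p))
  weight-regroup = solve-∀
  count-regroup : ∀ t → 3 * ((3 + t) * 4 * suc ((3 + t) * 4)) ≡ 4 * (3 * (3 + t) * (13 + 4 * t))
  count-regroup = solve-∀

apex-weight-too-small : ∀ t p → p < (3 + t) * 4 + (3 + t) * 4 → p * (5 + t) ≢ 3 * (3 + t) * (13 + 4 * t)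
apex-weight-too-small t p p<2N p-equation = m+1+n≰m ((23 + 8 * t) * (5 + t)) (begin
  (23 + 8 * t) * (5 + t) + suc (1 + 12 * t + 4 * (t * t)) ≡⟨ sym (margin t) ⟩
  3 * (3 + t) * (13 + 4 * t)                               ≡⟨ sym p-equation ⟩
  p * (5 + t)                                              ≤⟨ *-monoˡ-≤ (5 + t) p≤ ⟩
  (23 + 8 * t) * (5 + t)                                   ∎)
  where
  open ≤-Reasoning
  twice-N : ∀ t → (3 + t) * 4 + (3 + t) * 4 ≡ 24 + 8 * t
  twice-N = solve-∀
  margin : ∀ t → 3 * (3 + t) * (13 + 4 * t) ≡ (23 + 8 * t) * (5 + t) + suc (1 + 12 * t + 4 * (t * t))
  margin = solve-∀
  p≤ : p ≤ 23 + 8 * t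
  p≤ = s≤s⁻¹ (subst (suc p ≤_) (twice-N t) p<2N)

theorem3p1 : (n : ℕ) → 3 ≤ n → n % 2 ≡ 1 →
    (m : Fin (n ∸ 1) → Fin (n ∸ 1)) →
    (∀ i → m (m i) ≡ i) → (∀ i → m i ≢ i) →
    ¬ DistanceMagic (lex (joinK1 (KminusM (n ∸ 1) m)) (cycle 4))
-- Oddness of n only makes the perfect matching exist; the count refutes every n ≥ 3.
theorem3p1 (suc zero) (s≤s ())
theorem3p1 (suc (suc (suc t))) _ _ m m-involutive m-fixpoint-free (f , f-bijective , k , magic) =
  apex-weight-too-small t (antipodalSum {3 + t} ℓ zero) apex-bound
    (apex-weight-equation t (antipodalSum {3 + t} ℓ zero) (∑[ v < N ] ℓ v)
      total-label-sum (total-weight m m-involutive m-fixpoint-free ℓ magic))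
  where
  N : ℕ
  N = (3 + t) * 4
  ℓ : Fin N → ℕ
  ℓ v = suc (toℕ (f v))
  total-label-sum : 2 * ∑[ v < N ] ℓ v ≡ N * suc N
  total-label-sum = trans (cong (2 *_) (∑-bijection N (suc ∘ toℕ) f-bijective)) (∑-suc-toℕ N)
  0F≢2F : _≢_ {A = Fin 4} 0F 2F
  0F≢2F ()
  apex-bound : antipodalSum {3 + t} ℓ zero < N + N
  apex-bound = suc-toℕ-+-distinct-< (λ f-eq → 0F≢2F (combine-injectiveʳ {3 + t} zero 0F zero 2F (proj₁ f-bijective f-eq)))
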